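{- Let $G$ be a connected graph that is not complete. Then $b(G)\leq\theta(G)$. Moreover, if $\mathrm{diam}(G)=2$, then $b(G)=\theta(G)$.
   Context: All graphs are finite, simple, unweighted (each edge has length $1$); $\mathrm{diam}(G)$ is the maximum shortest-path distance between two vertices. The Borsuk number $b(G)$ of a connected graph $G$ is the minimum $k$ such that there is a set $F$ of edges for which the connected components $G_1,\dots,G_k$ of $G-F$ satisfy $\max\{\mathrm{diam}(G_1),\dots,\mathrm{diam}(G_k)\}<\mathrm{diam}(G)$. A clique cover of $G$ is a partition of $V(G)$ into sets each inducing a complete graph; $\theta(G)$ is the minimum size of a clique cover. -}

module Defs where

open import Data.Nat using (ℕ; zero; suc; _≤_; _<_)
open import Data.Fin using (Fin)
open import Data.Bool using (Bool; true; false)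
open import Data.Product using (Σ; ∃; _×_; _,_)
open import Relation.Binary.PropositionalEquality using (_≡_; _≢_)
open import Relation.Nullary using (¬_)

record Graph (n : ℕ) : Set where
  field
    adj    : Fin n → Fin n → Bool
    sym    : ∀ u v → adj u v ≡ adj v u
    irrefl : ∀ u → adj u u ≡ false
open Graph public

data Walk {n : ℕ} (G : Graph n) : Fin n → Fin n → ℕ → Set where
  nil  : ∀ {u} → Walk G u u 0
  cons : ∀ {u w v k} → adj G u w ≡ true → Walk G w v k → Walk G u v (suc k)

Connected : ∀ {n} → Graph n → Set
Connected G = ∀ u v → ∃ λ k → Walk G u v k

Complete : ∀ {n} → Graph n → Set
Complete G = ∀ u v → u ≢ v → adj G u v ≡ true

DistLe : ∀ {n} → Graph n → Fin _ → Fin _ → ℕ → Set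
DistLe {n} G u v d = Σ ℕ λ k → k ≤ d × Walk G u v k

IsDiam : ∀ {n} → Graph n → ℕ → Set
IsDiam G D =
  (∀ u v → DistLe G u v D) ×
  Σ _ λ u → Σ _ λ v → ∀ k → Walk G u v k → D ≤ k

-- H is a spanning subgraph of G (i.e. H = G - F for some edge set F).
SpanningSub : ∀ {n} → Graph n → Graph n → Set
SpanningSub H G = ∀ u v → adj H u v ≡ true → adj G u v ≡ true

Surjective : ∀ {n k} → (Fin n → Fin k) → Set
Surjective {n} {k} c = ∀ (i : Fin k) → Σ (Fin n) λ u → c u ≡ i

-- G - F has exactly k connected components, each of diameter < diam(G).
-- Components are encoded by a surjective labelling c : vertices → Fin k with
-- c u ≡ c v iff u and v are joined by a walk in H = G - F; the diameter of a
-- component is measured in H (the component is a union of reachability classes).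
Borsukable : ∀ {n} → Graph n → ℕ → Set
Borsukable {n} G k =
  Σ ℕ λ D → IsDiam G D ×
  Σ (Graph n) λ H → SpanningSub H G ×
  Σ (Fin n → Fin k) λ c → Surjective c ×
  (∀ u v m → Walk H u v m → c u ≡ c v) ×
  (∀ u v → c u ≡ c v → Σ ℕ λ m → m < D × Walk H u v m)

IsBorsukNumber : ∀ {n} → Graph n → ℕ → Set
IsBorsukNumber G b = Borsukable G b × (∀ m → Borsukable G m → b ≤ m)

HasCliqueCover : ∀ {n} → Graph n → ℕ → Set
HasCliqueCover {n} G k =
  Σ (Fin n → Fin k) λ c → Surjective c ×
  (∀ u v → u ≢ v → c u ≡ c v → adj G u v ≡ true)

IsCliqueCoverNumber : ∀ {n} → Graph n → ℕ → Set
IsCliqueCoverNumber G t = HasCliqueCover G t × (∀ m → HasCliqueCover G m → t ≤ m)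

module Submission where

-- A clique cover with t parts yields a Borsuk partition into t parts: delete every edge
-- between different cliques; each clique is then a component of diameter at most 1, and a
-- non-complete graph has diameter at least 2. Conversely, when diam G = 2 the components of
-- a Borsuk partition have diameter at most 1, i.e. they are cliques, so θ(G) ≤ b(G).

open import Defs
open import Data.Bool using (true; _∧_)
open import Data.Fin using (Fin)
open import Data.Fin.Properties using (_≟_)
open import Data.Nat using (ℕ; _≤_; _<_; z≤n; s≤s; _≤?_)
open import Data.Nat.Properties using (≤-antisym; ≤-trans; ≰⇒>)
open import Data.Product using (Σ; _×_; _,_; proj₁; proj₂)
open import Data.Empty using (⊥-elim)
open import Function.Bundles using (mk⇔)
open import Relation.Binary.PropositionalEquality using (_≡_; _≢_; refl; trans) renaming (sym to ≡-sym)
open import Relation.Nullary using (¬_; yes; no; does)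
open import Relation.Nullary.Decidable using (dec-true; does-⇔)

private
  variable
    n k D : ℕ

restrict : Graph n → (Fin n → Fin k) → Graph n
adj (restrict G c) u v = adj G u v ∧ does (c u ≟ c v)
Graph.sym (restrict G c) u v
  rewrite Graph.sym G u v | does-⇔ (mk⇔ ≡-sym ≡-sym) (c u ≟ c v) (c v ≟ c u) = refl
irrefl (restrict G c) u rewrite irrefl G u = refl

module _ (G : Graph n) (c : Fin n → Fin k) where

  restrict-adj⇒ : ∀ {u v} → adj (restrict G c) u v ≡ true → adj G u v ≡ true × c u ≡ c v
  restrict-adj⇒ {u} {v} with adj G u v | c u ≟ c v
  ... | true | yes cu≡cv = λ _ → refl , cu≡cv

  restrict-adj⇐ : ∀ {u v} → adj G u v ≡ true → c u ≡ c v → adj (restrict G c) u v ≡ true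
  restrict-adj⇐ {u} {v} uv cu≡cv rewrite uv | dec-true (c u ≟ c v) cu≡cv = refl

  restrict-spanning : SpanningSub (restrict G c) G
  restrict-spanning u v uv = proj₁ (restrict-adj⇒ uv)

  walk-restrict⇒sameClass : ∀ {u v m} → Walk (restrict G c) u v m → c u ≡ c v
  walk-restrict⇒sameClass nil         = refl
  walk-restrict⇒sameClass (cons uw w) = trans (proj₂ (restrict-adj⇒ uw)) (walk-restrict⇒sameClass w)

short-walk⇒adjacent : ∀ {G : Graph n} {u v m} → u ≢ v → m ≤ 1 → Walk G u v m → adj G u v ≡ true
short-walk⇒adjacent u≢v _ nil = ⊥-elim (u≢v refl)
short-walk⇒adjacent _ _ (cons uv nil) = uv
short-walk⇒adjacent _ (s≤s ()) (cons _ (cons _ _))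

diam-unique : ∀ {G : Graph n} {D E} → IsDiam G D → IsDiam G E → D ≡ E
diam-unique (allD , u , v , farD) (allE , u′ , v′ , farE) =
  ≤-antisym (let (m , m≤E , w) = allE u v   in ≤-trans (farD m w) m≤E)
            (let (m , m≤D , w) = allD u′ v′ in ≤-trans (farE m w) m≤D)

diam≤1⇒complete : ∀ {G : Graph n} → IsDiam G D → D ≤ 1 → Complete G
diam≤1⇒complete (all , _) D≤1 u v u≢v =
  let (m , m≤D , w) = all u v in short-walk⇒adjacent u≢v (≤-trans m≤D D≤1) w

¬complete⇒1<diam : ∀ {G : Graph n} → ¬ Complete G → IsDiam G D → 1 < D
¬complete⇒1<diam {D = D} ¬complete diam with D ≤? 1
... | yes D≤1 = ⊥-elim (¬complete (diam≤1⇒complete diam D≤1))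
... | no  D≰1 = ≰⇒> D≰1

cliqueCover⇒borsukable : ∀ {G : Graph n} {t} → ¬ Complete G → IsDiam G D →
                         HasCliqueCover G t → Borsukable G t
cliqueCover⇒borsukable {D = D} {G} ¬complete diam (c , surj , clique) =
  D , diam , restrict G c , restrict-spanning G c , c , surj ,
  (λ _ _ _ → walk-restrict⇒sameClass G c) , component-diam<D
  where
  1<D = ¬complete⇒1<diam ¬complete diam
  component-diam<D : ∀ u v → c u ≡ c v → Σ ℕ λ m → m < D × Walk (restrict G c) u v m
  component-diam<D u v cu≡cv with u ≟ v
  ... | yes refl = 0 , ≤-trans (s≤s z≤n) 1<D , nil
  ... | no u≢v   = 1 , 1<D , cons (restrict-adj⇐ G c (clique u v u≢v cu≡cv) cu≡cv) nil

borsukable⇒cliqueCover : ∀ {G : Graph n} {b} → IsDiam G 2 → Borsukable G b → HasCliqueCover G b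
borsukable⇒cliqueCover {G = G} diam₂ (_ , diam , H , H⊆G , c , surj , _ , component-diam<D) =
  c , surj , clique
  where
  clique : ∀ u v → u ≢ v → c u ≡ c v → adj G u v ≡ true
  clique u v u≢v cu≡cv with component-diam<D u v cu≡cv | diam-unique diam diam₂
  ... | m , s≤s m≤1 , w | refl = H⊆G u v (short-walk⇒adjacent u≢v m≤1 w)

lemma3 : ∀ (n : ℕ) (G : Graph n) → Connected G → ¬ Complete G →
         ∀ (b t : ℕ) → IsBorsukNumber G b → IsCliqueCoverNumber G t →
         b ≤ t × (IsDiam G 2 → b ≡ t)
lemma3 n G _ ¬complete b t (borsuk , b-minimal) (cover , t-minimal) =
  b≤t , λ diam₂ → ≤-antisym b≤t (t-minimal b (borsukable⇒cliqueCover diam₂ borsuk))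
  where
  diam = proj₁ (proj₂ borsuk)
  b≤t  = b-minimal t (cliqueCover⇒borsukable ¬complete diam cover)
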